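{- Let $M$ be a loopless matroid on a finite set $E$ with rank function $r$. Let $\mathbf{P}, \mathbf{P}'$ be optimal partitions of $S, S' \subseteq E$ respectively. If $r'(S) + r'(S') = r'(S\cup S') + r'(S\cap S')$, then $\mathbf{P}\vee\mathbf{P}'$ is optimal for $S \cup S'$ and $\mathbf{P}\wedge\mathbf{P}'$ is optimal for $S \cap S'$.
   Context: A partition of a finite set $S$ is a set of pairwise disjoint nonempty subsets of $S$ with union $S$. For a partition $\mathbf{P}$, $\tilde r(\mathbf{P}) := \sum_{P\in\mathbf{P}}(2r(P)-1)$, and $r'(S) := \min\{\tilde r(\mathbf{P}) : \mathbf{P}$ a partition of $S\}$; a partition $\mathbf{P}$ of $S$ is optimal for $S$ if $\tilde r(\mathbf{P}) = r'(S)$. For a multiset $\mathbf{S}$ of subsets of $E$, $\mathrm{fcc}(\mathbf{S})$ is the set of inclusion-wise minimal nonempty $T \subseteq \bigcup\mathbf{S}$ such that each $S\in\mathbf{S}$ satisfies $S\cap T=\emptyset$ or $S\subseteq T$. For partitions $\mathbf{P}$ of $S$ and $\mathbf{P}'$ of $S'$: $\mathbf{P}\vee\mathbf{P}' := \mathrm{fcc}(\mathbf{P}\cup\mathbf{P}')$, a partition of $S\cup S'$; $\mathbf{P}\wedge\mathbf{P}' := \{P\cap P' : P\in\mathbf{P},P'\in\mathbf{P}'\}\setminus\{\emptyset\}$, a partition of $S\cap S'$. -}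

module Defs where

open import Data.Nat using (ℕ; _+_; _*_; _∸_; _≤_)
open import Data.Fin using (Fin)
open import Data.Fin.Subset using (Subset; _∪_; _∩_; _⊆_; ⋃; ⁅_⁆; ∣_∣; Nonempty; Empty)
open import Data.Fin.Subset.Properties using (nonempty?)
open import Data.List using (List; []; _∷_; map; filter; concatMap)
open import Data.Nat.ListAction using (sum)
open import Data.List.Relation.Unary.All using (All)
open import Data.List.Relation.Unary.AllPairs using (AllPairs)
open import Data.Product using (Σ; ∃; _×_)
open import Data.Sum using (_⊎_)
open import Relation.Binary.PropositionalEquality using (_≡_)
open import Relation.Nullary using (¬_)

record Matroid (n : ℕ) : Set where
  field
    r        : Subset n → ℕ
    r-bound  : ∀ X → r X ≤ ∣ X ∣
    r-mono   : ∀ X Y → X ⊆ Y → r X ≤ r Y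
    r-submod : ∀ X Y → r (X ∪ Y) + r (X ∩ Y) ≤ r X + r Y

open Matroid public

Loopless : ∀ {n} → Matroid n → Set
Loopless {n} M = ∀ (e : Fin n) → ¬ (r M ⁅ e ⁆ ≡ 0)

-- A (finite) partition of S, represented as a list of blocks:
-- blocks nonempty, pairwise disjoint (hence distinct), union S.
IsPartition : ∀ {n} → Subset n → List (Subset n) → Set
IsPartition S Ps = All Nonempty Ps × AllPairs (λ P Q → Empty (P ∩ Q)) Ps × ⋃ Ps ≡ S

-- r̃(P) = Σ (2 r(P) - 1)  (exact in ℕ for nonempty blocks of a loopless matroid)
rtilde : ∀ {n} → Matroid n → List (Subset n) → ℕ
rtilde M Ps = sum (map (λ P → 2 * r M P ∸ 1) Ps)

IsRPrime : ∀ {n} → Matroid n → Subset n → ℕ → Set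
IsRPrime {n} M S k =
  (∃ λ (Ps : List (Subset n)) → IsPartition S Ps × rtilde M Ps ≡ k)
  × (∀ (Qs : List (Subset n)) → IsPartition S Qs → k ≤ rtilde M Qs)

Optimal : ∀ {n} → Matroid n → Subset n → List (Subset n) → Set
Optimal {n} M S Ps =
  IsPartition S Ps × (∀ (Qs : List (Subset n)) → IsPartition S Qs → rtilde M Ps ≤ rtilde M Qs)

Closed : ∀ {n} → List (Subset n) → Subset n → Set
Closed Fam T = All (λ X → Empty (X ∩ T) ⊎ X ⊆ T) Fam

InFcc : ∀ {n} → List (Subset n) → Subset n → Set
InFcc {n} Fam T =
  Nonempty T × T ⊆ ⋃ Fam × Closed Fam T
  × (∀ (T' : Subset n) → Nonempty T' → T' ⊆ ⋃ Fam → Closed Fam T' → T' ⊆ T → T' ≡ T)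

meet : ∀ {n} → List (Subset n) → List (Subset n) → List (Subset n)
meet Ps Ps' = filter nonempty? (concatMap (λ P → map (P ∩_) Ps') Ps)

{-# OPTIONS --safe #-}
-- Write cost(X) = 2 r(X) - 1, so that r̃(P) is the total cost of the blocks of P.  Optimality
-- of P′ for S′ means that merging blocks never helps; with submodularity this gives, for every
-- nonempty Y ⊆ S′, the restriction inequality Σ_{A ∈ P′} cost(Y ∩ A) ≤ cost(Y).
-- P ∨ P′ is built by absorbing the blocks B of P into P′ one at a time, B being merged with all
-- current blocks X that it meets.  Submodularity of r over these X gives
-- cost(B ∪ ⋃X) + Σ cost(X ∩ B) ≤ cost(B) + Σ cost(X), and the restriction inequality applied to
-- each X ∩ B bounds Σ_{A ∈ P′} cost(B ∩ A) by Σ cost(X ∩ B).  Summing over B,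
-- r̃(P ∨ P′) + r̃(P ∧ P′) ≤ r̃(P) + r̃(P′) = r′(S) + r′(S′) = r′(S ∪ S′) + r′(S ∩ S′), and as each
-- term on the left is at least the corresponding r′, both are equalities.
module Submission where

open import Defs
open import Data.Bool.Properties using () renaming (_≟_ to _≟ᵇ_)
open import Data.Empty using (⊥-elim)
open import Data.Fin using (Fin)
open import Data.Fin.Subset
  using (Subset; _∪_; _∩_; _⊆_; ⋃; ⁅_⁆; Nonempty; Empty; ⊥)
  renaming (_∈_ to _∈ₛ_)
open import Data.Fin.Subset.Properties
  using (∉⊥; x∈p∪q⁻; x∈p∪q⁺; x∈p∩q⁺; x∈p∩q⁻; ⊆-antisym; Empty-unique; ∣⊥∣≡0;
         x∈⁅y⁆⇒x≡y; nonempty?; ∪-assoc; ∪-comm; ∪-identityˡ; ∪-identityʳ; ∩-assoc; ∩-comm)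
open import Data.List using (List; []; _∷_; _++_; map; filter; foldr; length; concatMap)
open import Data.List.Membership.Propositional using (_∈_; find; lose)
open import Data.List.Membership.Propositional.Properties
  using (∈-filter⁺; ∈-filter⁻; ∈-∃++; ∈-++⁻; ∈-++⁺ˡ; ∈-++⁺ʳ; ∈-concatMap⁺; ∈-concatMap⁻; ∈-map⁺; ∈-map⁻)
open import Data.List.Properties using (map-++)
open import Data.List.Relation.Unary.All as All using (All; []; _∷_)
import Data.List.Relation.Unary.All.Properties as All
open import Data.List.Relation.Unary.AllPairs as AllPairs using (AllPairs; []; _∷_)
import Data.List.Relation.Unary.AllPairs.Properties as AllPairs
open import Data.List.Relation.Unary.Any using (here; there)
open import Data.List.Relation.Unary.Unique.Propositional using (Unique)
open import Data.Nat using (ℕ; _+_; _*_; _∸_; _≤_; z≤n)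
open import Data.Nat.ListAction using (sum)
open import Data.Nat.ListAction.Properties using (sum-++)
open import Data.Nat.Properties
open import Algebra.Properties.CommutativeSemigroup +-commutativeSemigroup
  using (interchange; x∙yz≈y∙xz; xy∙z≈xz∙y; xy∙z≈x∙zy; xy∙z≈y∙xz)
open import Data.Product using (∃; _×_; _,_; proj₁; proj₂)
open import Data.Sum using (_⊎_; inj₁; inj₂; [_,_]; [_,_]′)
open import Data.Vec.Properties using (≡-dec)
open import Function using (_∘_; case_of_)
open import Function.Bundles using (_⇔_; Equivalence)
open import Relation.Binary.PropositionalEquality
  using (_≡_; _≢_; refl; sym; trans; cong; cong₂; subst; module ≡-Reasoning)
open import Relation.Nullary using (¬_; Dec; yes; no)
open import Relation.Unary using (Decidable)
open import Relation.Unary.Properties using (∁?)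

private
  variable
    n : ℕ
    x : Fin n
    P Q X Y Z : Subset n
    Xs Ys : List (Subset n)
    A B : Set

_≟ₛ_ : (P Q : Subset n) → Dec (P ≡ Q)
_≟ₛ_ = ≡-dec _≟ᵇ_

∈-∩⁺ : x ∈ₛ P → x ∈ₛ Q → x ∈ₛ P ∩ Q
∈-∩⁺ p q = x∈p∩q⁺ (p , q)

∈-∩⁻ˡ : x ∈ₛ P ∩ Q → x ∈ₛ P
∈-∩⁻ˡ {P = P} {Q} h = proj₁ (x∈p∩q⁻ P Q h)

∈-∩⁻ʳ : x ∈ₛ P ∩ Q → x ∈ₛ Q
∈-∩⁻ʳ {P = P} {Q} h = proj₂ (x∈p∩q⁻ P Q h)

∈-∪⁺ˡ : x ∈ₛ P → x ∈ₛ P ∪ Q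
∈-∪⁺ˡ h = x∈p∪q⁺ (inj₁ h)

∈-∪⁺ʳ : x ∈ₛ Q → x ∈ₛ P ∪ Q
∈-∪⁺ʳ h = x∈p∪q⁺ (inj₂ h)

∈-∪⁻ : x ∈ₛ P ∪ Q → x ∈ₛ P ⊎ x ∈ₛ Q
∈-∪⁻ {P = P} {Q} = x∈p∪q⁻ P Q

∈-⋃⁺ : X ∈ Xs → x ∈ₛ X → x ∈ₛ ⋃ Xs
∈-⋃⁺ (here refl) h = ∈-∪⁺ˡ h
∈-⋃⁺ (there p)   h = ∈-∪⁺ʳ (∈-⋃⁺ p h)

∈-⋃⁻ : ∀ Xs → x ∈ₛ ⋃ Xs → ∃ λ X → X ∈ Xs × x ∈ₛ X
∈-⋃⁻ []       h = ⊥-elim (∉⊥ h)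
∈-⋃⁻ (X ∷ Xs) h with ∈-∪⁻ h
... | inj₁ h′ = X , here refl , h′
... | inj₂ h′ with Y , Y∈ , h″ ← ∈-⋃⁻ Xs h′ = Y , there Y∈ , h″

⋃-++ : ∀ (Xs Ys : List (Subset n)) → ⋃ (Xs ++ Ys) ≡ ⋃ Xs ∪ ⋃ Ys
⋃-++ []       Ys = sym (∪-identityˡ (⋃ Ys))
⋃-++ (X ∷ Xs) Ys = trans (cong (X ∪_) (⋃-++ Xs Ys)) (sym (∪-assoc X (⋃ Xs) (⋃ Ys)))

Disjoint : Subset n → Subset n → Set
Disjoint P Q = Empty (P ∩ Q)

Disjoint-sym : Disjoint P Q → Disjoint Q P
Disjoint-sym d (x , h) = d (x , ∈-∩⁺ (∈-∩⁻ʳ h) (∈-∩⁻ˡ h))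

Disjoint⇒∉ : Disjoint P Q → x ∈ₛ P → ¬ x ∈ₛ Q
Disjoint⇒∉ d p q = d (_ , ∈-∩⁺ p q)

Disjoint-⊆ : X ⊆ P → Y ⊆ Q → Disjoint P Q → Disjoint X Y
Disjoint-⊆ X⊆P Y⊆Q P#Q (x , h) = P#Q (x , ∈-∩⁺ (X⊆P (∈-∩⁻ˡ h)) (Y⊆Q (∈-∩⁻ʳ h)))

Disjoint-⋃ : All (Disjoint X) Ys → Disjoint X (⋃ Ys)
Disjoint-⋃ {Ys = Ys} ds (x , h) with Y , Y∈Ys , x∈Y ← ∈-⋃⁻ Ys (∈-∩⁻ʳ h) =
  Disjoint⇒∉ (All.lookup ds Y∈Ys) (∈-∩⁻ˡ h) x∈Y

Disjoint-∪ : Disjoint P Z → Disjoint Q Z → Disjoint (P ∪ Q) Z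
Disjoint-∪ P#Z Q#Z (x , h) with ∈-∪⁻ (∈-∩⁻ˡ h)
... | inj₁ x∈P = Disjoint⇒∉ P#Z x∈P (∈-∩⁻ʳ h)
... | inj₂ x∈Q = Disjoint⇒∉ Q#Z x∈Q (∈-∩⁻ʳ h)

AllPairs-Disjoint-∈ : AllPairs Disjoint Xs → X ∈ Xs → Y ∈ Xs → X ≢ Y → Disjoint X Y
AllPairs-Disjoint-∈ (_  ∷ _)   (here refl) (here refl) X≢Y = ⊥-elim (X≢Y refl)
AllPairs-Disjoint-∈ (ds ∷ _)   (here refl) (there q)   _   = All.lookup ds q
AllPairs-Disjoint-∈ (ds ∷ _)   (there p)   (here refl) _   = Disjoint-sym (All.lookup ds p)
AllPairs-Disjoint-∈ (_  ∷ dss) (there p)   (there q)   X≢Y = AllPairs-Disjoint-∈ dss p q X≢Y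

∑ : {A : Set} → (A → ℕ) → List A → ℕ
∑ f xs = sum (map f xs)

∑-++ : ∀ (f : A → ℕ) xs ys → ∑ f (xs ++ ys) ≡ ∑ f xs + ∑ f ys
∑-++ f xs ys = trans (cong sum (map-++ f xs ys)) (sum-++ (map f xs) (map f ys))

∑-cong : ∀ {f g : A → ℕ} xs → (∀ {x} → x ∈ xs → f x ≡ g x) → ∑ f xs ≡ ∑ g xs
∑-cong []       _  = refl
∑-cong (x ∷ xs) eq = cong₂ _+_ (eq (here refl)) (∑-cong xs (eq ∘ there))

∑-mono-≤ : ∀ {f g : A → ℕ} xs → (∀ {x} → x ∈ xs → f x ≤ g x) → ∑ f xs ≤ ∑ g xs
∑-mono-≤ []       _  = z≤n
∑-mono-≤ (x ∷ xs) le = +-mono-≤ (le (here refl)) (∑-mono-≤ xs (le ∘ there))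

∑-≡0 : ∀ {f : A → ℕ} xs → (∀ {x} → x ∈ xs → f x ≡ 0) → ∑ f xs ≡ 0
∑-≡0 []       _  = refl
∑-≡0 (x ∷ xs) eq = cong₂ _+_ (eq (here refl)) (∑-≡0 xs (eq ∘ there))

∑-distrib-+ : ∀ (f g : A → ℕ) xs → ∑ (λ x → f x + g x) xs ≡ ∑ f xs + ∑ g xs
∑-distrib-+ f g []       = refl
∑-distrib-+ f g (x ∷ xs) =
  trans (cong (f x + g x +_) (∑-distrib-+ f g xs)) (interchange (f x) (g x) _ _)

∑-partition : ∀ {P : A → Set} (P? : Decidable P) (f : A → ℕ) xs →
              ∑ f xs ≡ ∑ f (filter P? xs) + ∑ f (filter (∁? P?) xs)
∑-partition P? f []       = refl
∑-partition P? f (x ∷ xs) with P? x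
... | yes _ = trans (cong (f x +_) (∑-partition P? f xs)) (sym (+-assoc (f x) _ _))
... | no  _ = trans (cong (f x +_) (∑-partition P? f xs)) (x∙yz≈y∙xz (f x) (∑ f (filter P? xs)) _)

∑-filter : ∀ {P : A → Set} (P? : Decidable P) (f : A → ℕ) → (∀ {x} → ¬ P x → f x ≡ 0) →
           ∀ xs → ∑ f (filter P? xs) ≡ ∑ f xs
∑-filter P? f ¬P⇒0 []       = refl
∑-filter P? f ¬P⇒0 (x ∷ xs) with P? x
... | yes _  = cong (f x +_) (∑-filter P? f ¬P⇒0 xs)
... | no ¬Px = trans (∑-filter P? f ¬P⇒0 xs) (cong (_+ ∑ f xs) (sym (¬P⇒0 ¬Px)))

∑-map : ∀ (f : B → ℕ) (g : A → B) xs → ∑ f (map g xs) ≡ ∑ (f ∘ g) xs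
∑-map f g []       = refl
∑-map f g (x ∷ xs) = cong (f (g x) +_) (∑-map f g xs)

∑-concatMap : ∀ (f : B → ℕ) (g : A → List B) xs →
              ∑ f (concatMap g xs) ≡ ∑ (∑ f ∘ g) xs
∑-concatMap f g []       = refl
∑-concatMap f g (x ∷ xs) =
  trans (∑-++ f (g x) (concatMap g xs)) (cong (∑ f (g x) +_) (∑-concatMap f g xs))

∑-comm : ∀ (f : A → B → ℕ) xs ys →
         ∑ (λ x → ∑ (f x) ys) xs ≡ ∑ (λ y → ∑ (λ x → f x y) xs) ys
∑-comm f []       ys = sym (∑-≡0 ys (λ _ → refl))
∑-comm f (x ∷ xs) ys = trans (cong (∑ (f x) ys +_) (∑-comm f xs ys))
                             (sym (∑-distrib-+ (f x) (λ y → ∑ (λ x → f x y) xs) ys))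

∑-mono-⊆ : ∀ (f : A → ℕ) {xs ys} → Unique xs → (∀ {x} → x ∈ xs → x ∈ ys) → ∑ f xs ≤ ∑ f ys
∑-mono-⊆ f {[]}     _            _   = z≤n
∑-mono-⊆ f {x ∷ xs} (x∉xs ∷ !xs) xs⊆ys with ys₁ , ys₂ , refl ← ∈-∃++ (xs⊆ys (here refl)) = begin
  f x + ∑ f xs                 ≤⟨ +-monoʳ-≤ (f x) (∑-mono-⊆ f !xs xs⊆ys₁++ys₂) ⟩
  f x + ∑ f (ys₁ ++ ys₂)       ≡⟨ cong (f x +_) (∑-++ f ys₁ ys₂) ⟩
  f x + (∑ f ys₁ + ∑ f ys₂)    ≡⟨ x∙yz≈y∙xz (f x) (∑ f ys₁) (∑ f ys₂) ⟩
  ∑ f ys₁ + (f x + ∑ f ys₂)    ≡⟨ ∑-++ f ys₁ (x ∷ ys₂) ⟨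
  ∑ f (ys₁ ++ x ∷ ys₂)         ∎
  where
  open ≤-Reasoning
  xs⊆ys₁++ys₂ : ∀ {y} → y ∈ xs → y ∈ ys₁ ++ ys₂
  xs⊆ys₁++ys₂ {y} y∈xs with ∈-++⁻ ys₁ (xs⊆ys (there y∈xs))
  ... | inj₁ y∈ys₁         = ∈-++⁺ˡ y∈ys₁
  ... | inj₂ (here y≡x)    = ⊥-elim (All.lookup x∉xs y∈xs (sym y≡x))
  ... | inj₂ (there y∈ys₂) = ∈-++⁺ʳ ys₁ y∈ys₂

+-squeeze : ∀ {x y c d} → x + y ≤ c + d → c ≤ x → d ≤ y → x ≤ c × y ≤ d
+-squeeze {x} {y} {c} {d} x+y≤c+d c≤x d≤y =
  +-cancelʳ-≤ y x c (≤-trans x+y≤c+d (+-monoʳ-≤ c d≤y)) ,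
  +-cancelˡ-≤ x y d (≤-trans x+y≤c+d (+-monoˡ-≤ d c≤x))

block-containing : ∀ {S Ps} → IsPartition {n} S Ps → x ∈ₛ S → ∃ λ X → X ∈ Ps × x ∈ₛ X
block-containing {x = x} {Ps = Ps} (_ , _ , ⋃Ps≡S) h = ∈-⋃⁻ Ps (subst (x ∈ₛ_) (sym ⋃Ps≡S) h)

block⊆ : ∀ {S Ps} → IsPartition {n} S Ps → X ∈ Ps → X ⊆ S
block⊆ {X = X} (_ , _ , ⋃Ps≡S) X∈ = subst (X ⊆_) ⋃Ps≡S (∈-⋃⁺ X∈)

module _ {D : Subset n → Set} (D? : Decidable D) where

  ⋃-partition : ∀ Xs → ⋃ (filter D? Xs) ∪ ⋃ (filter (∁? D?) Xs) ≡ ⋃ Xs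
  ⋃-partition []       = ∪-identityˡ ⊥
  ⋃-partition (X ∷ Xs) with D? X
  ... | yes _ = trans (∪-assoc X _ _) (cong (X ∪_) (⋃-partition Xs))
  ... | no  _ = begin
    F ∪ (X ∪ G) ≡⟨ ∪-assoc F X G ⟨
    (F ∪ X) ∪ G ≡⟨ cong (_∪ G) (∪-comm F X) ⟩
    (X ∪ F) ∪ G ≡⟨ ∪-assoc X F G ⟩
    X ∪ (F ∪ G) ≡⟨ cong (X ∪_) (⋃-partition Xs) ⟩
    X ∪ ⋃ Xs    ∎
    where
    open ≡-Reasoning
    F = ⋃ (filter D? Xs); G = ⋃ (filter (∁? D?) Xs)

  ⋃-filter-Disjoint-∁ : AllPairs Disjoint Xs →
                        All (Disjoint (⋃ (filter D? Xs))) (filter (∁? D?) Xs)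
  ⋃-filter-Disjoint-∁ {Xs = Xs} #Xs = All.tabulate λ N∈ →
    Disjoint-sym (Disjoint-⋃ (All.tabulate λ X∈ → N#X N∈ X∈))
    where
    N#X : Y ∈ filter (∁? D?) Xs → X ∈ filter D? Xs → Disjoint Y X
    N#X Y∈ X∈ with Y∈Xs , ¬DY ← ∈-filter⁻ (∁? D?) {xs = Xs} Y∈
                 | X∈Xs , DX  ← ∈-filter⁻ D? {xs = Xs} X∈ =
      AllPairs-Disjoint-∈ #Xs Y∈Xs X∈Xs λ { refl → ¬DY DX }

  coarsen-isPartition : ∀ {S Ps} → IsPartition S Ps → Nonempty (⋃ (filter D? Ps)) →
                        IsPartition S (⋃ (filter D? Ps) ∷ filter (∁? D?) Ps)
  coarsen-isPartition {Ps = Ps} (Ps≢∅ , #Ps , ⋃Ps≡S) ⋃≢∅ =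
    ⋃≢∅ ∷ All.filter⁺ (∁? D?) Ps≢∅ ,
    ⋃-filter-Disjoint-∁ #Ps ∷ AllPairs.filter⁺ (∁? D?) #Ps ,
    trans (⋃-partition Ps) ⋃Ps≡S

meet-isPartition : ∀ {S S′ Ps Ps′} → IsPartition {n} S Ps → IsPartition S′ Ps′ →
                   IsPartition (S ∩ S′) (meet Ps Ps′)
meet-isPartition {S = S} {S′} {Ps} {Ps′} Ps-part@(_ , #Ps , _) Ps′-part@(_ , #Ps′ , _) =
  All.all-filter nonempty? pairs , AllPairs.filter⁺ nonempty? #pairs , ⊆-antisym ⋃meet⊆ ⊆⋃meet
  where
  pairs = concatMap (λ P → map (P ∩_) Ps′) Ps
  #pairs : AllPairs Disjoint pairs
  #pairs = AllPairs.concat⁺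
    (All.map⁺ (All.tabulate λ _ → AllPairs.map⁺ (AllPairs.map (Disjoint-⊆ ∈-∩⁻ʳ ∈-∩⁻ʳ) #Ps′)))
    (AllPairs.map⁺ (AllPairs.map (λ P#Q → All.map⁺ (All.tabulate λ _ → All.map⁺ (All.tabulate λ _ →
       Disjoint-⊆ ∈-∩⁻ˡ ∈-∩⁻ˡ P#Q))) #Ps))
  ⋃meet⊆ : ⋃ (meet Ps Ps′) ⊆ S ∩ S′
  ⋃meet⊆ h with Z , Z∈ , x∈Z ← ∈-⋃⁻ (meet Ps Ps′) h
           with P , P∈ , Z∈′ ← find (∈-concatMap⁻ (λ P → map (P ∩_) Ps′) {xs = Ps}
                                                  (proj₁ (∈-filter⁻ nonempty? {xs = pairs} Z∈)))
           with P′ , P′∈ , refl ← ∈-map⁻ (P ∩_) Z∈′ =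
    ∈-∩⁺ (block⊆ Ps-part P∈ (∈-∩⁻ˡ x∈Z)) (block⊆ Ps′-part P′∈ (∈-∩⁻ʳ x∈Z))
  ⊆⋃meet : S ∩ S′ ⊆ ⋃ (meet Ps Ps′)
  ⊆⋃meet {x} h with P , P∈ , x∈P ← block-containing Ps-part (∈-∩⁻ˡ h)
               with P′ , P′∈ , x∈P′ ← block-containing Ps′-part (∈-∩⁻ʳ h) =
    ∈-⋃⁺ (∈-filter⁺ nonempty? (∈-concatMap⁺ (λ P → map (P ∩_) Ps′) (lose P∈ (∈-map⁺ (P ∩_) P′∈)))
                    (x , ∈-∩⁺ x∈P x∈P′))
         (∈-∩⁺ x∈P x∈P′)

-- Finest common coarsenings

Closed-∩ : ∀ {Fam T U} → Closed {n} Fam T → Closed Fam U → Closed Fam (T ∩ U)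
Closed-∩ T-cl U-cl = All.zipWith both (T-cl , U-cl)
  where
  both : ∀ {Z T U} → (Disjoint {n} Z T ⊎ Z ⊆ T) × (Disjoint Z U ⊎ Z ⊆ U) → Disjoint Z (T ∩ U) ⊎ Z ⊆ T ∩ U
  both (inj₁ Z#T , _)        = inj₁ (Disjoint-⊆ (λ h → h) ∈-∩⁻ˡ Z#T)
  both (inj₂ _   , inj₁ Z#U) = inj₁ (Disjoint-⊆ (λ h → h) ∈-∩⁻ʳ Z#U)
  both (inj₂ Z⊆T , inj₂ Z⊆U) = inj₂ λ h → ∈-∩⁺ (Z⊆T h) (Z⊆U h)

Closed⇒⊆ : ∀ {Fam T} → Closed {n} Fam T → Z ∈ Fam → x ∈ₛ Z → x ∈ₛ T → Z ⊆ T
Closed⇒⊆ cl Z∈Fam x∈Z x∈T with All.lookup cl Z∈Fam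
... | inj₁ Z#T = ⊥-elim (Disjoint⇒∉ Z#T x∈Z x∈T)
... | inj₂ Z⊆T = Z⊆T

InFcc-≡ : ∀ {Fam T U} → InFcc {n} Fam T → InFcc Fam U → Nonempty (T ∩ U) → T ≡ U
InFcc-≡ {T = T} {U} (_ , T⊆ , T-cl , T-min) (_ , _ , U-cl , U-min) T∩U≢∅ =
  trans (sym (T-min (T ∩ U) T∩U≢∅ (T⊆ ∘ ∈-∩⁻ˡ) T∩U-cl ∈-∩⁻ˡ))
        (U-min (T ∩ U) T∩U≢∅ (T⊆ ∘ ∈-∩⁻ˡ) T∩U-cl ∈-∩⁻ʳ)
  where T∩U-cl = Closed-∩ T-cl U-cl

InFcc-∷ : ∀ {Fam N B} → Disjoint {n} B N → InFcc Fam N → InFcc (B ∷ Fam) N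
InFcc-∷ B#N (N≢∅ , N⊆ , N-cl , N-min) =
  N≢∅ , ∈-∪⁺ʳ ∘ N⊆ , inj₁ B#N ∷ N-cl ,
  λ T T≢∅ _ T-cl T⊆N → N-min T T≢∅ (N⊆ ∘ T⊆N) (All.tail T-cl) T⊆N

record FccPartition (Fam Xs : List (Subset n)) : Set where
  field
    isPartition : IsPartition (⋃ Fam) Xs
    components  : All (InFcc Fam) Xs

  block-of : x ∈ₛ ⋃ Fam → ∃ λ X → X ∈ Xs × x ∈ₛ X
  block-of = block-containing isPartition

  component-closed : X ∈ Xs → Closed Fam X
  component-closed = proj₁ ∘ proj₂ ∘ proj₂ ∘ All.lookup components

partition⇒FccPartition : ∀ {S Ps} → IsPartition {n} S Ps → FccPartition Ps Ps
partition⇒FccPartition {Ps = Ps} (Ps≢∅ , #Ps , _) = record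
  { isPartition = Ps≢∅ , #Ps , refl
  ; components  = All.tabulate λ X∈ → All.lookup Ps≢∅ X∈ , ∈-⋃⁺ X∈ , closed X∈ , minimal X∈
  }
  where
  closed : X ∈ Ps → Closed Ps X
  closed {X} X∈ = All.tabulate λ {Z} Z∈ → case Z ≟ₛ X of λ where
    (yes refl) → inj₂ λ {_} h → h
    (no Z≢X)   → inj₁ (AllPairs-Disjoint-∈ #Ps Z∈ X∈ Z≢X)
  minimal : X ∈ Ps → ∀ T → Nonempty T → T ⊆ ⋃ Ps → Closed Ps T → T ⊆ X → T ≡ X
  minimal X∈ T (t , t∈T) _ T-cl T⊆X = ⊆-antisym T⊆X (Closed⇒⊆ T-cl X∈ (T⊆X t∈T) t∈T)

module _ {Fam Xs : List (Subset n)} (fp : FccPartition Fam Xs) where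
  open FccPartition fp

  fcc-complete : ∀ {T} → InFcc Fam T → T ∈ Xs
  fcc-complete T-fcc@((t , t∈T) , T⊆ , _) with Y , Y∈ , t∈Y ← block-of (T⊆ t∈T) =
    subst (_∈ Xs) (sym (InFcc-≡ T-fcc (All.lookup components Y∈) (t , ∈-∩⁺ t∈T t∈Y))) Y∈

  fcc-list-isPartition : ∀ {J} → Unique J → (∀ T → (T ∈ J) ⇔ InFcc Fam T) → IsPartition (⋃ Fam) J
  fcc-list-isPartition {J} !J J⇔fcc =
    All.map proj₁ J-fcc , distinct-Disjoint !J J-fcc , ⊆-antisym ⋃J⊆ ⊆⋃J
    where
    J-fcc : All (InFcc Fam) J
    J-fcc = All.tabulate (Equivalence.to (J⇔fcc _))
    distinct-Disjoint : ∀ {Ts} → Unique Ts → All (InFcc Fam) Ts → AllPairs Disjoint Ts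
    distinct-Disjoint []           []              = []
    distinct-Disjoint (≢Ts ∷ !Ts) (T-fcc ∷ Ts-fcc) =
      All.zipWith (λ (T≢U , U-fcc) T∩U≢∅ → T≢U (InFcc-≡ T-fcc U-fcc T∩U≢∅)) (≢Ts , Ts-fcc)
      ∷ distinct-Disjoint !Ts Ts-fcc
    ⋃J⊆ : ⋃ J ⊆ ⋃ Fam
    ⋃J⊆ h with T , T∈ , x∈T ← ∈-⋃⁻ J h = proj₁ (proj₂ (All.lookup J-fcc T∈)) x∈T
    ⊆⋃J : ⋃ Fam ⊆ ⋃ J
    ⊆⋃J h with X , X∈ , x∈X ← block-of h =
      ∈-⋃⁺ (Equivalence.from (J⇔fcc X) (All.lookup components X∈)) x∈X

meets? : (B : Subset n) → Decidable (λ X → Nonempty (X ∩ B))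
meets? B X = nonempty? (X ∩ B)

absorb : Subset n → List (Subset n) → List (Subset n)
absorb B Xs = (B ∪ ⋃ (filter (meets? B) Xs)) ∷ filter (∁? (meets? B)) Xs

module _ {Fam Xs : List (Subset n)} (fp : FccPartition Fam Xs) {B : Subset n} (B≢∅ : Nonempty B) where
  open FccPartition fp

  private
    Ms = filter (meets? B) Xs
    Ns = filter (∁? (meets? B)) Xs
    Y₀ = B ∪ ⋃ Ms

    Ms⊆Xs : X ∈ Ms → X ∈ Xs
    Ms⊆Xs = proj₁ ∘ ∈-filter⁻ (meets? B) {xs = Xs}

    Ms-meet-B : X ∈ Ms → Nonempty (X ∩ B)
    Ms-meet-B = All.lookup (All.all-filter (meets? B) Xs)

  absorb-isPartition : IsPartition (⋃ (B ∷ Fam)) (absorb B Xs)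
  absorb-isPartition = let Xs≢∅ , #Xs , ⋃Xs≡⋃Fam = isPartition in
    (proj₁ B≢∅ , ∈-∪⁺ˡ (proj₂ B≢∅)) ∷ All.filter⁺ (∁? (meets? B)) Xs≢∅ ,
    All.zipWith (λ (N#B , ⋃Ms#N) → Disjoint-∪ (Disjoint-sym N#B) ⋃Ms#N)
                (All.all-filter (∁? (meets? B)) Xs , ⋃-filter-Disjoint-∁ (meets? B) #Xs)
      ∷ AllPairs.filter⁺ (∁? (meets? B)) #Xs ,
    trans (∪-assoc B (⋃ Ms) (⋃ Ns)) (cong (B ∪_) (trans (⋃-partition (meets? B) Xs) ⋃Xs≡⋃Fam))

  private
    -- A member of Fam that meets Y₀ lies in a single component of Xs, and that component is in Ms.
    Y₀-closed : Closed (B ∷ Fam) Y₀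
    Y₀-closed = inj₂ ∈-∪⁺ˡ ∷ All.tabulate Fam-member
      where
      Fam-member : Z ∈ Fam → Disjoint Z Y₀ ⊎ Z ⊆ Y₀
      Fam-member {Z} Z∈ with nonempty? (Z ∩ Y₀)
      ... | no  Z#Y₀       = inj₁ Z#Y₀
      ... | yes (x , x∈Z∩Y₀) = inj₂ (inside-component (∈-∪⁻ (∈-∩⁻ʳ x∈Z∩Y₀)))
        where
        x∈Z = ∈-∩⁻ˡ x∈Z∩Y₀
        via : X ∈ Ms → x ∈ₛ X → Z ⊆ Y₀
        via X∈ x∈X = ∈-∪⁺ʳ ∘ ∈-⋃⁺ X∈ ∘ Closed⇒⊆ (component-closed (Ms⊆Xs X∈)) Z∈ x∈Z x∈X
        inside-component : x ∈ₛ B ⊎ x ∈ₛ ⋃ Ms → Z ⊆ Y₀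
        inside-component (inj₁ x∈B) with X , X∈ , x∈X ← block-of (∈-⋃⁺ Z∈ x∈Z) =
          via (∈-filter⁺ (meets? B) X∈ (x , ∈-∩⁺ x∈X x∈B)) x∈X
        inside-component (inj₂ x∈⋃Ms) with X , X∈ , x∈X ← ∈-⋃⁻ Ms x∈⋃Ms = via X∈ x∈X

    Y₀-minimal : ∀ T → Nonempty T → Closed (B ∷ Fam) T → T ⊆ Y₀ → Y₀ ⊆ T
    Y₀-minimal T (t , t∈T) T-cl T⊆Y₀ = [ B⊆T , ⋃Ms⊆T B⊆T ] ∘ ∈-∪⁻
      where
      component⊆T : X ∈ Ms → Nonempty (T ∩ X) → X ⊆ T
      component⊆T X∈ T∩X≢∅ {x} x∈X with _ , X⊆ , X-cl , X-min ← All.lookup components (Ms⊆Xs X∈) =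
        ∈-∩⁻ˡ (subst (x ∈ₛ_) (sym T∩X≡X) x∈X)
        where T∩X≡X = X-min (T ∩ _) T∩X≢∅ (X⊆ ∘ ∈-∩⁻ʳ) (Closed-∩ (All.tail T-cl) X-cl) ∈-∩⁻ʳ
      ⋃Ms⊆T : B ⊆ T → ⋃ Ms ⊆ T
      ⋃Ms⊆T B⊆T x∈⋃Ms with X , X∈ , x∈X ← ∈-⋃⁻ Ms x∈⋃Ms with y , y∈X∩B ← Ms-meet-B X∈ =
        component⊆T X∈ (y , ∈-∩⁺ (B⊆T (∈-∩⁻ʳ y∈X∩B)) (∈-∩⁻ˡ y∈X∩B)) x∈X
      B⊆T : B ⊆ T
      B⊆T with ∈-∪⁻ (T⊆Y₀ t∈T)
      ... | inj₁ t∈B = Closed⇒⊆ T-cl (here refl) t∈B t∈T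
      ... | inj₂ t∈⋃Ms with X , X∈ , t∈X ← ∈-⋃⁻ Ms t∈⋃Ms with y , y∈X∩B ← Ms-meet-B X∈ =
        Closed⇒⊆ T-cl (here refl) (∈-∩⁻ʳ y∈X∩B) (component⊆T X∈ (t , ∈-∩⁺ t∈T t∈X) (∈-∩⁻ˡ y∈X∩B))

  absorb-FccPartition : FccPartition (B ∷ Fam) (absorb B Xs)
  absorb-FccPartition = record
    { isPartition = absorb-isPartition
    ; components  =
        ( All.head (proj₁ absorb-isPartition) , block⊆ absorb-isPartition (here refl) , Y₀-closed
        , λ T T≢∅ _ T-cl T⊆Y₀ → ⊆-antisym T⊆Y₀ (Y₀-minimal T T≢∅ T-cl T⊆Y₀) )
        ∷ All.zipWith (λ (N#B , N-fcc) → InFcc-∷ (Disjoint-sym N#B) N-fcc)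
                      (All.all-filter (∁? (meets? B)) Xs , All.filter⁺ (∁? (meets? B)) components)
    }

-- join Ps Ps′ is P ∨ P′ = fcc(Ps ++ Ps′), as join-FccPartition shows.
join : List (Subset n) → List (Subset n) → List (Subset n)
join Ps Ps′ = foldr absorb Ps′ Ps

join-FccPartition : ∀ {S′ Ps Ps′} → IsPartition {n} S′ Ps′ → All Nonempty Ps →
                    FccPartition (Ps ++ Ps′) (join Ps Ps′)
join-FccPartition Ps′-part []            = partition⇒FccPartition Ps′-part
join-FccPartition Ps′-part (B≢∅ ∷ Ps≢∅) = absorb-FccPartition (join-FccPartition Ps′-part Ps≢∅) B≢∅

-- The cost 2 r(P) - 1 of a block

module Cost {n : ℕ} (M : Matroid n) (loopless : Loopless M) where

  -- rtilde M Ps is ∑ cost Ps by definition.  The truncated subtraction is exact on nonempty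
  -- sets (cost+1) and only sends the empty set to 0.
  cost : Subset n → ℕ
  cost Z = 2 * r M Z ∸ 1

  r-empty : Empty Z → r M Z ≡ 0
  r-empty Z-empty rewrite Empty-unique Z-empty =
    n≤0⇒n≡0 (subst (r M ⊥ ≤_) (∣⊥∣≡0 n) (r-bound M ⊥))

  r-positive : Nonempty Z → 1 ≤ r M Z
  r-positive {Z} (x , x∈Z) = ≤-trans (n≢0⇒n>0 (loopless x)) (r-mono M ⁅ x ⁆ Z ⁅x⁆⊆Z)
    where
    ⁅x⁆⊆Z : ⁅ x ⁆ ⊆ Z
    ⁅x⁆⊆Z y∈⁅x⁆ rewrite x∈⁅y⁆⇒x≡y x y∈⁅x⁆ = x∈Z

  cost-empty : Empty Z → cost Z ≡ 0
  cost-empty Z-empty = cong (λ k → 2 * k ∸ 1) (r-empty Z-empty)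

  cost+1 : Nonempty Z → cost Z + 1 ≡ 2 * r M Z
  cost+1 {Z} Z-nonempty = m∸n+n≡m (≤-trans (r-positive Z-nonempty) (m≤m+n (r M Z) _))

  ∑cost+length : ∀ (h : A → Subset n) xs → All (Nonempty ∘ h) xs →
                 ∑ (cost ∘ h) xs + length xs ≡ 2 * ∑ (r M ∘ h) xs
  ∑cost+length h []       []       = refl
  ∑cost+length h (x ∷ xs) (p ∷ ps) = begin
    cost (h x) + C + (1 + length xs)   ≡⟨ interchange (cost (h x)) C 1 (length xs) ⟩
    (cost (h x) + 1) + (C + length xs) ≡⟨ cong₂ _+_ (cost+1 p) (∑cost+length h xs ps) ⟩
    2 * r M (h x) + 2 * R              ≡⟨ *-distribˡ-+ 2 (r M (h x)) R ⟨
    2 * (r M (h x) + R)                ∎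
    where
    open ≡-Reasoning
    C = ∑ (cost ∘ h) xs
    R = ∑ (r M ∘ h) xs

  r-submodular-⋃ : ∀ Q Xs → AllPairs Disjoint Xs →
                   r M (Q ∪ ⋃ Xs) + ∑ (λ X → r M (X ∩ Q)) Xs ≤ r M Q + ∑ (r M) Xs
  r-submodular-⋃ Q []       [] = ≤-reflexive (cong (_+ 0) (cong (r M) (∪-identityʳ Q)))
  r-submodular-⋃ Q (X ∷ Ys) (X#Ys ∷ #Ys) = begin
    r M (Q ∪ (X ∪ V)) + (r M (X ∩ Q) + T) ≡⟨ cong₂ (λ s t → r M s + (r M t + T)) ∪-shuffle ∩-absorb ⟩
    r M (U ∪ X) + (r M (U ∩ X) + T)       ≡⟨ +-assoc (r M (U ∪ X)) _ T ⟨
    r M (U ∪ X) + r M (U ∩ X) + T         ≤⟨ +-monoˡ-≤ T (r-submod M U X) ⟩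
    r M U + r M X + T                     ≡⟨ xy∙z≈xz∙y (r M U) (r M X) T ⟩
    (r M U + T) + r M X                   ≤⟨ +-monoˡ-≤ (r M X) (r-submodular-⋃ Q Ys #Ys) ⟩
    (r M Q + ∑ (r M) Ys) + r M X          ≡⟨ xy∙z≈x∙zy (r M Q) (∑ (r M) Ys) (r M X) ⟩
    r M Q + (r M X + ∑ (r M) Ys)          ∎
    where
    open ≤-Reasoning
    V = ⋃ Ys
    U = Q ∪ V
    T = ∑ (λ X → r M (X ∩ Q)) Ys
    ∪-shuffle : Q ∪ (X ∪ V) ≡ U ∪ X
    ∪-shuffle = trans (cong (Q ∪_) (∪-comm X V)) (sym (∪-assoc Q V X))
    ∩-absorb : X ∩ Q ≡ U ∩ X
    ∩-absorb = ⊆-antisym (λ h → ∈-∩⁺ (∈-∪⁺ˡ (∈-∩⁻ʳ h)) (∈-∩⁻ˡ h))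
                         (λ h → ∈-∩⁺ (∈-∩⁻ʳ h) (inQ (∈-∩⁻ʳ h) (∈-∪⁻ (∈-∩⁻ˡ h))))
      where
      inQ : x ∈ₛ X → x ∈ₛ Q ⊎ x ∈ₛ V → x ∈ₛ Q
      inQ _   (inj₁ x∈Q) = x∈Q
      inQ x∈X (inj₂ x∈V) = ⊥-elim (Disjoint⇒∉ (Disjoint-⋃ X#Ys) x∈X x∈V)

  cost-submodular-⋃ : ∀ Q Xs → Nonempty Q → All Nonempty Xs → All (λ X → Nonempty (X ∩ Q)) Xs →
                      AllPairs Disjoint Xs →
                      cost (Q ∪ ⋃ Xs) + ∑ (λ X → cost (X ∩ Q)) Xs ≤ cost Q + ∑ cost Xs
  cost-submodular-⋃ Q Xs Q≢∅@(q , q∈Q) Xs≢∅ Xs∩Q≢∅ #Xs = +-cancelʳ-≤ (1 + k) _ _ (begin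
    (cost U + ∑ (cost ∘ (_∩ Q)) Xs) + (1 + k) ≡⟨ interchange (cost U) _ 1 k ⟩
    (cost U + 1) + (∑ (cost ∘ (_∩ Q)) Xs + k) ≡⟨ cong₂ _+_ (cost+1 (q , ∈-∪⁺ˡ q∈Q))
                                                          (∑cost+length (_∩ Q) Xs Xs∩Q≢∅) ⟩
    2 * r M U + 2 * ∑ (r M ∘ (_∩ Q)) Xs      ≡⟨ *-distribˡ-+ 2 (r M U) _ ⟨
    2 * (r M U + ∑ (r M ∘ (_∩ Q)) Xs)        ≤⟨ *-monoʳ-≤ 2 (r-submodular-⋃ Q Xs #Xs) ⟩
    2 * (r M Q + ∑ (r M) Xs)                 ≡⟨ *-distribˡ-+ 2 (r M Q) _ ⟩
    2 * r M Q + 2 * ∑ (r M) Xs               ≡⟨ cong₂ _+_ (cost+1 Q≢∅) (∑cost+length (λ X → X) Xs Xs≢∅) ⟨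
    (cost Q + 1) + (∑ cost Xs + k)           ≡⟨ interchange (cost Q) _ 1 k ⟨
    (cost Q + ∑ cost Xs) + (1 + k)           ∎)
    where
    open ≤-Reasoning
    U = Q ∪ ⋃ Xs
    k = length Xs

  ∑cost-∩-block : ∀ Z Xs → Z ⊆ ⋃ Xs → AllPairs Disjoint Xs → All (λ X → Disjoint Z X ⊎ Z ⊆ X) Xs →
                  ∑ (λ X → cost (X ∩ Z)) Xs ≡ cost Z
  ∑cost-∩-block Z []       Z⊆⊥ _ _ = sym (cost-empty λ (_ , x∈Z) → ∉⊥ (Z⊆⊥ x∈Z))
  ∑cost-∩-block Z (X ∷ Xs) _ (X#Xs ∷ _) (inj₂ Z⊆X ∷ _) = begin
    cost (X ∩ Z) + ∑ (λ Y → cost (Y ∩ Z)) Xs ≡⟨ cong₂ _+_ (cong cost X∩Z≡Z) (∑-≡0 Xs ∩Z-empty) ⟩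
    cost Z + 0                              ≡⟨ +-identityʳ (cost Z) ⟩
    cost Z                                  ∎
    where
    open ≡-Reasoning
    X∩Z≡Z = ⊆-antisym ∈-∩⁻ʳ (λ h → ∈-∩⁺ (Z⊆X h) h)
    ∩Z-empty : Y ∈ Xs → cost (Y ∩ Z) ≡ 0
    ∩Z-empty Y∈ = cost-empty λ (_ , h) → Disjoint⇒∉ (All.lookup X#Xs Y∈) (Z⊆X (∈-∩⁻ʳ h)) (∈-∩⁻ˡ h)
  ∑cost-∩-block Z (X ∷ Xs) Z⊆ (_ ∷ #Xs) (inj₁ Z#X ∷ Z-cl) =
    trans (cong (_+ ∑ (λ Y → cost (Y ∩ Z)) Xs) (cost-empty (Disjoint-sym Z#X)))
          (∑cost-∩-block Z Xs Z⊆⋃Xs #Xs Z-cl)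
    where
    Z⊆⋃Xs : Z ⊆ ⋃ Xs
    Z⊆⋃Xs x∈Z with ∈-∪⁻ (Z⊆ x∈Z)
    ... | inj₁ x∈X   = ⊥-elim (Disjoint⇒∉ Z#X x∈Z x∈X)
    ... | inj₂ x∈⋃Xs = x∈⋃Xs

  optimal-∑cost≤cost-⋃ : ∀ {S Ps} {D : Subset n → Set} (D? : Decidable D) → Optimal M S Ps →
                         Nonempty (⋃ (filter D? Ps)) → ∑ cost (filter D? Ps) ≤ cost (⋃ (filter D? Ps))
  optimal-∑cost≤cost-⋃ {Ps = Ps} D? (Ps-part , Ps-opt) ⋃≢∅ =
    +-cancelʳ-≤ (∑ cost Ns) _ _
      (subst (_≤ cost (⋃ Ms) + ∑ cost Ns) (∑-partition D? cost Ps)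
             (Ps-opt _ (coarsen-isPartition D? Ps-part ⋃≢∅)))
    where
    Ms = filter D? Ps
    Ns = filter (∁? D?) Ps

  optimal-∑cost-∩ : ∀ {S Ps Y} → Optimal M S Ps → Y ⊆ S → Nonempty Y →
                    ∑ (λ A → cost (Y ∩ A)) Ps ≤ cost Y
  optimal-∑cost-∩ {Ps = Ps} {Y} Ps-opt@(Ps-part@(Ps≢∅ , #Ps , _) , _) Y⊆S Y≢∅@(y , y∈Y) = begin
    ∑ (cost ∘ (Y ∩_)) Ps ≡⟨ ∑-cong Ps (λ {A} _ → cong cost (∩-comm Y A)) ⟩
    ∑ (cost ∘ (_∩ Y)) Ps ≡⟨ ∑-filter (meets? Y) _ cost-empty Ps ⟨
    C∩                   ≤⟨ +-cancelˡ-≤ (cost (⋃ Ms)) _ _ submodular ⟩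
    cost Y               ∎
    where
    open ≤-Reasoning
    Ms = filter (meets? Y) Ps
    C∩ = ∑ (cost ∘ (_∩ Y)) Ms
    Y⊆⋃Ms : Y ⊆ ⋃ Ms
    Y⊆⋃Ms x∈Y with A , A∈ , x∈A ← block-containing Ps-part (Y⊆S x∈Y) =
      ∈-⋃⁺ (∈-filter⁺ (meets? Y) A∈ (_ , ∈-∩⁺ x∈A x∈Y)) x∈A
    Y∪⋃Ms≡⋃Ms : Y ∪ ⋃ Ms ≡ ⋃ Ms
    Y∪⋃Ms≡⋃Ms = ⊆-antisym (λ h → [ Y⊆⋃Ms , (λ x∈ → x∈) ]′ (∈-∪⁻ h)) ∈-∪⁺ʳ
    ⋃Ms≢∅ = y , Y⊆⋃Ms y∈Y
    submodular : cost (⋃ Ms) + C∩ ≤ cost (⋃ Ms) + cost Y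
    submodular = begin
      cost (⋃ Ms) + C∩     ≡⟨ cong (λ U → cost U + C∩) Y∪⋃Ms≡⋃Ms ⟨
      cost (Y ∪ ⋃ Ms) + C∩ ≤⟨ cost-submodular-⋃ Y Ms Y≢∅ (All.filter⁺ (meets? Y) Ps≢∅)
                                                 (All.all-filter (meets? Y) Ps)
                                                 (AllPairs.filter⁺ (meets? Y) #Ps) ⟩
      cost Y + ∑ cost Ms   ≤⟨ +-monoʳ-≤ (cost Y) (optimal-∑cost≤cost-⋃ (meets? Y) Ps-opt ⋃Ms≢∅) ⟩
      cost Y + cost (⋃ Ms) ≡⟨ +-comm (cost Y) _ ⟩
      cost (⋃ Ms) + cost Y ∎

  absorb-cost : ∀ {S Ps Bs Xs B} → Optimal M S Ps → FccPartition (Bs ++ Ps) Xs → Nonempty B →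
                All (Disjoint B) Bs →
                ∑ cost (absorb B Xs) + ∑ (λ A → cost (B ∩ A)) Ps ≤ ∑ cost Xs + cost B
  absorb-cost {S} {Ps} {Bs} {Xs} {B} Ps-opt fp B≢∅ B#Bs = begin
    (cost Y₀ + ∑ cost Ns) + ∑ (λ A → cost (B ∩ A)) Ps ≤⟨ +-monoʳ-≤ (cost Y₀ + ∑ cost Ns) meet-bound ⟩
    (cost Y₀ + ∑ cost Ns) + ∑ (cost ∘ (_∩ B)) Ms     ≡⟨ xy∙z≈xz∙y (cost Y₀) (∑ cost Ns) _ ⟩
    (cost Y₀ + ∑ (cost ∘ (_∩ B)) Ms) + ∑ cost Ns     ≤⟨ +-monoˡ-≤ (∑ cost Ns) submodular ⟩
    (cost B + ∑ cost Ms) + ∑ cost Ns                 ≡⟨ +-assoc (cost B) (∑ cost Ms) (∑ cost Ns) ⟩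
    cost B + (∑ cost Ms + ∑ cost Ns)                 ≡⟨ cong (cost B +_) (∑-partition _ cost Xs) ⟨
    cost B + ∑ cost Xs                               ≡⟨ +-comm (cost B) (∑ cost Xs) ⟩
    ∑ cost Xs + cost B                               ∎
    where
    open ≤-Reasoning
    open FccPartition fp
    Ms = filter (meets? B) Xs
    Ns = filter (∁? (meets? B)) Xs
    Y₀ = B ∪ ⋃ Ms
    #Ms = AllPairs.filter⁺ (meets? B) (proj₁ (proj₂ isPartition))

    Ms⊆Xs : X ∈ Ms → X ∈ Xs
    Ms⊆Xs = proj₁ ∘ ∈-filter⁻ (meets? B) {xs = Xs}

    Ms-meet-B : X ∈ Ms → Nonempty (X ∩ B)
    Ms-meet-B = All.lookup (All.all-filter (meets? B) Xs)

    submodular : cost Y₀ + ∑ (cost ∘ (_∩ B)) Ms ≤ cost B + ∑ cost Ms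
    submodular = cost-submodular-⋃ B Ms B≢∅ (All.filter⁺ (meets? B) (proj₁ isPartition))
                                   (All.all-filter (meets? B) Xs) #Ms

    X∩B⊆S : X ∈ Ms → X ∩ B ⊆ S
    X∩B⊆S X∈ h with ∈-∪⁻ (subst (_ ∈ₛ_) (⋃-++ Bs Ps) (block⊆ isPartition (Ms⊆Xs X∈) (∈-∩⁻ˡ h)))
    ... | inj₁ x∈⋃Bs = ⊥-elim (Disjoint⇒∉ (Disjoint-⋃ B#Bs) (∈-∩⁻ʳ h) x∈⋃Bs)
    ... | inj₂ x∈⋃Ps = subst (_ ∈ₛ_) (proj₂ (proj₂ (proj₁ Ps-opt))) x∈⋃Ps

    B∩A-in-one-block : ∀ {A} → A ∈ Ps → ∑ (λ X → cost (X ∩ (B ∩ A))) Ms ≡ cost (B ∩ A)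
    B∩A-in-one-block {A} A∈ = ∑cost-∩-block (B ∩ A) Ms B∩A⊆⋃Ms #Ms (All.tabulate A-closed)
      where
      A∈Fam = ∈-++⁺ʳ Bs A∈
      B∩A⊆⋃Ms : B ∩ A ⊆ ⋃ Ms
      B∩A⊆⋃Ms h with X , X∈ , x∈X ← block-of (∈-⋃⁺ A∈Fam (∈-∩⁻ʳ h)) =
        ∈-⋃⁺ (∈-filter⁺ (meets? B) X∈ (_ , ∈-∩⁺ x∈X (∈-∩⁻ˡ h))) x∈X
      A-closed : X ∈ Ms → Disjoint (B ∩ A) X ⊎ B ∩ A ⊆ X
      A-closed X∈ with All.lookup (component-closed (Ms⊆Xs X∈)) A∈Fam
      ... | inj₁ A#X = inj₁ (Disjoint-⊆ ∈-∩⁻ʳ (λ h → h) A#X)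
      ... | inj₂ A⊆X = inj₂ (A⊆X ∘ ∈-∩⁻ʳ)

    meet-bound : ∑ (λ A → cost (B ∩ A)) Ps ≤ ∑ (cost ∘ (_∩ B)) Ms
    meet-bound = begin
      ∑ (λ A → cost (B ∩ A)) Ps                       ≡⟨ ∑-cong Ps B∩A-in-one-block ⟨
      ∑ (λ A → ∑ (λ X → cost (X ∩ (B ∩ A))) Ms) Ps    ≡⟨ ∑-comm (λ A X → cost (X ∩ (B ∩ A))) Ps Ms ⟩
      ∑ (λ X → ∑ (λ A → cost (X ∩ (B ∩ A))) Ps) Ms    ≡⟨ ∑-cong Ms (λ {X} _ → ∑-cong Ps λ {A} _ →
                                                           cong cost (∩-assoc X B A)) ⟨
      ∑ (λ X → ∑ (λ A → cost ((X ∩ B) ∩ A)) Ps) Ms    ≤⟨ ∑-mono-≤ Ms (λ X∈ →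
                                                           optimal-∑cost-∩ Ps-opt (X∩B⊆S X∈) (Ms-meet-B X∈)) ⟩
      ∑ (cost ∘ (_∩ B)) Ms                            ∎

  join-cost : ∀ {S′ Ps Ps′} → Optimal M S′ Ps′ → All Nonempty Ps → AllPairs Disjoint Ps →
              ∑ cost (join Ps Ps′) + ∑ (λ P → ∑ (λ P′ → cost (P ∩ P′)) Ps′) Ps ≤ ∑ cost Ps + ∑ cost Ps′
  join-cost {Ps = []}     {Ps′} _       _             _           =
    ≤-reflexive (+-identityʳ (∑ cost Ps′))
  join-cost {Ps = B ∷ Ps} {Ps′} Ps′-opt (B≢∅ ∷ Ps≢∅) (B#Ps ∷ #Ps) = begin
    ∑ cost (absorb B J) + (W B + ∑ W Ps) ≡⟨ +-assoc (∑ cost (absorb B J)) (W B) (∑ W Ps) ⟨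
    ∑ cost (absorb B J) + W B + ∑ W Ps   ≤⟨ +-monoˡ-≤ (∑ W Ps) absorb-step ⟩
    ∑ cost J + cost B + ∑ W Ps           ≡⟨ xy∙z≈y∙xz (∑ cost J) (cost B) (∑ W Ps) ⟩
    cost B + (∑ cost J + ∑ W Ps)         ≤⟨ +-monoʳ-≤ (cost B) (join-cost Ps′-opt Ps≢∅ #Ps) ⟩
    cost B + (∑ cost Ps + ∑ cost Ps′)    ≡⟨ +-assoc (cost B) (∑ cost Ps) (∑ cost Ps′) ⟨
    cost B + ∑ cost Ps + ∑ cost Ps′      ∎
    where
    open ≤-Reasoning
    J = join Ps Ps′
    W : Subset n → ℕ
    W B = ∑ (λ A → cost (B ∩ A)) Ps′
    absorb-step = absorb-cost Ps′-opt (join-FccPartition (proj₁ Ps′-opt) Ps≢∅) B≢∅ B#Ps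

  ∑cost-meet : ∀ Ps Ps′ → ∑ cost (meet Ps Ps′) ≡ ∑ (λ P → ∑ (λ P′ → cost (P ∩ P′)) Ps′) Ps
  ∑cost-meet Ps Ps′ = begin
    ∑ cost (meet Ps Ps′)                                ≡⟨ ∑-filter nonempty? cost cost-empty pairs ⟩
    ∑ cost (concatMap (λ P → map (P ∩_) Ps′) Ps)        ≡⟨ ∑-concatMap cost (λ P → map (P ∩_) Ps′) Ps ⟩
    ∑ (λ P → ∑ cost (map (P ∩_) Ps′)) Ps                ≡⟨ ∑-cong Ps (λ {P} _ → ∑-map cost (P ∩_) Ps′) ⟩
    ∑ (λ P → ∑ (λ P′ → cost (P ∩ P′)) Ps′) Ps           ∎
    where
    open ≡-Reasoning
    pairs = concatMap (λ P → map (P ∩_) Ps′) Ps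

  ∑cost-join+meet : ∀ {S S′ Ps Ps′} → Optimal M S Ps → Optimal M S′ Ps′ →
                    ∑ cost (join Ps Ps′) + ∑ cost (meet Ps Ps′) ≤ ∑ cost Ps + ∑ cost Ps′
  ∑cost-join+meet {Ps = Ps} {Ps′} ((Ps≢∅ , #Ps , _) , _) Ps′-opt =
    subst (λ m → ∑ cost (join Ps Ps′) + m ≤ ∑ cost Ps + ∑ cost Ps′) (sym (∑cost-meet Ps Ps′))
          (join-cost Ps′-opt Ps≢∅ #Ps)

optimal-≤-r′ : ∀ {M : Matroid n} {S Ps a} → Optimal M S Ps → IsRPrime M S a → rtilde M Ps ≤ a
optimal-≤-r′ (_ , Ps-opt) ((Qs , Qs-part , refl) , _) = Ps-opt Qs Qs-part

lemma4p1 : ∀ {n : ℕ} (M : Matroid n) → Loopless M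
    → (S S' : Subset n) (Ps Ps' : List (Subset n))
    → Optimal M S Ps → Optimal M S' Ps'
    → (a b c d : ℕ)
    → IsRPrime M S a → IsRPrime M S' b → IsRPrime M (S ∪ S') c → IsRPrime M (S ∩ S') d
    → a + b ≡ c + d
    → ((J : List (Subset n)) → Unique J → (∀ T → (T ∈ J) ⇔ InFcc (Ps ++ Ps') T)
         → Optimal M (S ∪ S') J)
      × Optimal M (S ∩ S') (meet Ps Ps')
lemma4p1 M loopless S S' Ps Ps' Ps-opt Ps'-opt a b c d a-r′ b-r′ c-r′ d-r′ a+b≡c+d =
  join-optimal , (meet-part , λ Qs Qs-part → ≤-trans (proj₂ tight) (proj₂ d-r′ Qs Qs-part))
  where
  open Cost M loopless
  Ps-part = proj₁ Ps-opt
  Ps'-part = proj₁ Ps'-opt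
  join-fcc = join-FccPartition Ps'-part (proj₁ Ps-part)
  ⋃Ps++Ps'≡S∪S' = trans (⋃-++ Ps Ps') (cong₂ _∪_ (proj₂ (proj₂ Ps-part)) (proj₂ (proj₂ Ps'-part)))
  join-part = subst (λ U → IsPartition U (join Ps Ps')) ⋃Ps++Ps'≡S∪S' (FccPartition.isPartition join-fcc)
  meet-part = meet-isPartition Ps-part Ps'-part
  tight : rtilde M (join Ps Ps') ≤ c × rtilde M (meet Ps Ps') ≤ d
  tight = +-squeeze (≤-trans (∑cost-join+meet Ps-opt Ps'-opt) (≤-trans Ps+Ps'≤a+b (≤-reflexive a+b≡c+d)))
                    (proj₂ c-r′ _ join-part) (proj₂ d-r′ _ meet-part)
    where Ps+Ps'≤a+b = +-mono-≤ (optimal-≤-r′ {M = M} Ps-opt a-r′) (optimal-≤-r′ {M = M} Ps'-opt b-r′)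
  join-optimal : (J : List (Subset _)) → Unique J → (∀ T → (T ∈ J) ⇔ InFcc (Ps ++ Ps') T) →
                 Optimal M (S ∪ S') J
  join-optimal J !J J⇔fcc =
    subst (λ U → IsPartition U J) ⋃Ps++Ps'≡S∪S' (fcc-list-isPartition join-fcc !J J⇔fcc) ,
    λ Qs Qs-part → ≤-trans (∑-mono-⊆ cost !J (fcc-complete join-fcc ∘ Equivalence.to (J⇔fcc _)))
                           (≤-trans (proj₁ tight) (proj₂ c-r′ Qs Qs-part))
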